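{- Let $T$ be a standard Young tableau of any shape $\lambda$ with $N$ boxes. In the construction of the $\mathsf{m}$-diagram of $T$, for every entry $i$ not in the bottom row, say in row $r+1$, at the $i$-th step the set of entries $j$ of row $r$ with $j<i$ that are not yet joined by an arc to an entry of row $r+1$ is nonempty. Hence the map from $T$ to its $\mathsf{m}$-diagram is well-defined.
   Context: Tableau conventions: rows are left-justified and numbered $1,2,\dots$ from the bottom (bottom row longest); a standard Young tableau with $N$ boxes is a filling by $1,\dots,N$, each once, increasing left to right along rows and bottom to top along columns. $\mathsf{m}$-diagram construction: place points $1,\dots,N$ in order on a horizontal line; for $i=1,\dots,N$ in increasing order, if $i$ lies in row $r+1$ ($r\ge1$), let $j$ be the largest entry of row $r$ with $j<i$ that is not already joined by an arc to an entry of row $r+1$, and join $j$ and $i$ by an arc (upper semicircle with diameter $[j,i]$). -}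

module Defs where

open import Data.Nat using (ℕ; zero; suc; _<_; _≤_; _<?_; _≟_)
open import Data.Bool using (Bool; true; false; _∧_; not; if_then_else_)
open import Data.Product using (_×_; _,_)
open import Data.Maybe using (Maybe; just; nothing)
open import Data.List using (List; []; _∷_; length; concat; map; upTo; filter; _++_)
open import Data.Nat.ListAction using (sum)
open import Data.Bool.ListAction using (any)
open import Relation.Nullary.Decidable using (_×-dec_)
open import Data.Bool using (T?)
open import Data.List.Relation.Unary.All using (All)
open import Data.List.Relation.Unary.Linked using (Linked)
open import Data.List.Relation.Binary.Permutation.Propositional using (_↭_)
open import Relation.Nullary.Decidable using (⌊_⌋)
open import Relation.Binary.PropositionalEquality using (_≢_)

-- A tableau is given by its list of rows, bottom row first (row 1 = head).
-- Each row lists its entries left to right.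
Tableau : Set
Tableau = List (List ℕ)

-- k-th row (0-indexed; row k here is row k+1 in the paper), [] if absent
rowAt : Tableau → ℕ → List ℕ
rowAt []       _       = []
rowAt (r ∷ _)  zero    = r
rowAt (_ ∷ rs) (suc k) = rowAt rs k

-- c-th entry of a row (0-indexed), 0 if absent
entryAt : List ℕ → ℕ → ℕ
entryAt []       _       = 0
entryAt (x ∷ _)  zero    = x
entryAt (_ ∷ xs) (suc c) = entryAt xs c

shape : Tableau → List ℕ
shape T = map length T

size : Tableau → ℕ
size T = sum (shape T)

IsPartition : List ℕ → Set
IsPartition λs = All (0 <_) λs × Linked (λ a b → b ≤ a) λs

IsSYT : Tableau → Set
IsSYT T =
  IsPartition (shape T) ×
  (concat T ↭ map suc (upTo (size T))) ×
  All (Linked _<_) T ×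
  (∀ k c → c < length (rowAt T (suc k)) →
     entryAt (rowAt T k) c < entryAt (rowAt T (suc k)) c)

elemB : ℕ → List ℕ → Bool
elemB x xs = any (λ y → ⌊ x ≟ y ⌋) xs

-- arcs are pairs (j , i) with j < i
Arcs : Set
Arcs = List (ℕ × ℕ)

joinedTo : Arcs → List ℕ → ℕ → Bool
joinedTo A upper j = any (λ { (a , b) → ⌊ a ≟ j ⌋ ∧ elemB b upper }) A

-- Candidates at the step for entry i lying in (0-indexed) row suc k, i.e. paper's row r+1
-- with r = k+1 ≥ 1: entries j of row r with j < i not already joined to an entry of row r+1.
candidates : Tableau → ℕ → Arcs → ℕ → List ℕ
candidates T k A i =
  filter (λ j → (j <? i) ×-dec T? (not (joinedTo A (rowAt T (suc k)) j))) (rowAt T k)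

maxL : List ℕ → Maybe ℕ
maxL []       = nothing
maxL (x ∷ xs) with maxL xs
... | nothing = just x
... | just m  = just (Data.Nat._⊔_ x m)

rowOf : Tableau → ℕ → Maybe ℕ
rowOf []       i = nothing
rowOf (r ∷ rs) i = if elemB i r then just 0 else Data.Maybe.map suc (rowOf rs i)
  where import Data.Maybe

-- one step of the m-diagram construction for entry i: if i lies in a row above the bottom
-- one, join it to the largest candidate (if the candidate set is empty, which the lemma
-- shows never happens, nothing is added)
step : Tableau → Arcs → ℕ → Arcs
step T A i with rowOf T i
... | nothing      = A
... | just zero    = A
... | just (suc k) with maxL (candidates T k A i)
...   | nothing = A
...   | just j  = A ++ ((j , i) ∷ [])

arcsUpTo : Tableau → ℕ → Arcs
arcsUpTo T zero    = []
arcsUpTo T (suc n) = step T (arcsUpTo T n) (suc n)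

module Submission where

-- Let i = m + 1 lie in row r+1 =: U, let
-- L be row r and A the arcs drawn in steps 1, …, m.  Write #{x ∈ X ∣ φ x}
-- for the number of entries of a row X satisfying φ.  If no candidate were
-- left for i, every entry of L below i would already be joined to U, so
--
--   #{b ∈ U ∣ b < i}  <  #{j ∈ L ∣ j < i}             (column strictness)
--                     ≤  #{j ∈ L ∣ j joined to U}      (no candidate left)
--                     ≤  #{arcs of A ending in U}      (rows have no repeats)
--                     ≤  #{b ∈ U ∣ b < i}              (step b adds ≤ 1 arc, ending at b)
--
-- a contradiction.

open import Defs
open import Level using (Level)
open import Data.Nat using (ℕ; zero; suc; _+_; _∸_; _<_; _≤_; _<?_; z≤n; s≤s; z<s; s<s)
open import Data.Nat.Properties
  using (≤-refl; ≤-reflexive; ≤-trans; <-trans; <-irrefl; <-asym; <⇒≢; n≤1+n;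
         m<n⇒m<1+n; m≤n⇒m≤1+n; +-mono-≤; +-monoʳ-≤; +-comm; +-suc; +-identityʳ; module ≤-Reasoning)
open import Data.Bool using (true; false; T; T?; not)
open import Data.Maybe using (just; nothing)
open import Data.Bool.Properties using (T-∧; T-∨)
open import Data.Product using (_×_; _,_; proj₁; proj₂; ∃-syntax)
open import Data.Sum using (_⊎_; inj₁; inj₂; [_,_]; map₁)
open import Data.Empty using (⊥-elim)
open import Data.List using (List; []; _∷_; _++_; length; filter; concat; map; upTo)
open import Data.List.Properties using (filter-accept; filter-reject; filter-none; filter-++; length-++)
open import Data.List.Membership.Propositional using (_∈_)
open import Data.List.Membership.Propositional.Properties using (∈-filter⁺; ∈-map⁻; ∈-++⁺ˡ; ∈-++⁺ʳ)
open import Data.List.Relation.Unary.Any using (here; there)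
import Data.List.Relation.Unary.Any as Any
open import Data.List.Relation.Unary.Any.Properties using (any⁻)
open import Data.List.Relation.Unary.All using (All; []; _∷_)
import Data.List.Relation.Unary.All as All
open import Data.List.Relation.Unary.AllPairs using (AllPairs; _∷_)
import Data.List.Relation.Unary.AllPairs as AllPairs
open import Data.List.Relation.Unary.Linked using (Linked; _∷_)
open import Data.List.Relation.Unary.Linked.Properties using (Linked⇒AllPairs)
open import Data.List.Relation.Unary.Unique.Propositional using (Unique)
open import Data.List.Relation.Binary.Permutation.Propositional using (_↭_)
open import Data.List.Relation.Binary.Permutation.Propositional.Properties using (∈-resp-↭)
open import Function using (_∘_; id; Equivalence)
open import Relation.Nullary using (¬_; yes; no)
open import Relation.Nullary.Decidable using (toWitness)
open import Relation.Unary using (Pred; Decidable)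
open import Relation.Binary.Definitions using (DecidableEquality)
open import Relation.Binary.PropositionalEquality using (_≡_; _≢_; refl; sym; trans; cong; subst)

private
  variable
    a p q r : Level
    X : Set a
    x y : X
    xs : List X

count : {P : Pred X p} → Decidable P → List X → ℕ
count P? xs = length (filter P? xs)

module _ {P : Pred X p} (P? : Decidable P) where

  count-accept : P x → count P? (x ∷ xs) ≡ suc (count P? xs)
  count-accept px = cong length (filter-accept P? px)

  count-reject : ¬ P x → count P? (x ∷ xs) ≡ count P? xs
  count-reject ¬px = cong length (filter-reject P? ¬px)

  count-none : All (¬_ ∘ P) xs → count P? xs ≡ 0
  count-none none = cong length (filter-none P? none)

  count-++ : (xs ys : List X) → count P? (xs ++ ys) ≡ count P? xs + count P? ys
  count-++ xs ys = trans (cong length (filter-++ P? xs ys)) (length-++ (filter P? xs))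

  count-cons : (x : X) (xs : List X) → count P? xs ≤ count P? (x ∷ xs)
  count-cons x xs with P? x
  ... | yes _ = n≤1+n _
  ... | no  _ = ≤-refl

module _ {P : Pred X p} {Q : Pred X q} (P? : Decidable P) (Q? : Decidable Q) where

  count-mono : (xs : List X) → (∀ {x} → x ∈ xs → P x → Q x) → count P? xs ≤ count Q? xs
  count-mono []       P⇒Q = z≤n
  count-mono (x ∷ xs) P⇒Q with P? x | Q? x
  ... | yes _  | yes _ = s≤s (count-mono xs (P⇒Q ∘ there))
  ... | yes px | no ¬qx = ⊥-elim (¬qx (P⇒Q (here refl) px))
  ... | no _   | yes _ = m≤n⇒m≤1+n (count-mono xs (P⇒Q ∘ there))
  ... | no _   | no _  = count-mono xs (P⇒Q ∘ there)

  count-mono-strict : (∀ {x} → x ∈ xs → P x → Q x) →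
                      y ∈ xs → Q y → ¬ P y → count P? xs < count Q? xs
  count-mono-strict {x ∷ xs} P⇒Q (here refl) qy ¬py = begin-strict
    count P? (x ∷ xs)  ≡⟨ count-reject P? ¬py ⟩
    count P? xs        <⟨ s≤s (count-mono xs (P⇒Q ∘ there)) ⟩
    suc (count Q? xs)  ≡⟨ sym (count-accept Q? qy) ⟩
    count Q? (x ∷ xs)  ∎
    where open ≤-Reasoning
  count-mono-strict {x ∷ xs} P⇒Q (there y∈xs) qy ¬py with P? x | Q? x
  ... | yes _  | yes _ = s≤s (count-mono-strict (P⇒Q ∘ there) y∈xs qy ¬py)
  ... | yes px | no ¬qx = ⊥-elim (¬qx (P⇒Q (here refl) px))
  ... | no _   | yes _ = m<n⇒m<1+n (count-mono-strict (P⇒Q ∘ there) y∈xs qy ¬py)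
  ... | no _   | no _  = count-mono-strict (P⇒Q ∘ there) y∈xs qy ¬py

  count-∪ : {R : Pred X r} (R? : Decidable R) →
            (∀ {x} → P x → Q x ⊎ R x) → (xs : List X) →
            count P? xs ≤ count Q? xs + count R? xs
  count-∪ R? P⇒Q∪R [] = z≤n
  count-∪ R? P⇒Q∪R (x ∷ xs) with P? x
  ... | no _ = ≤-trans (count-∪ R? P⇒Q∪R xs) (+-mono-≤ (count-cons Q? x xs) (count-cons R? x xs))
  ... | yes px with P⇒Q∪R px
  ...   | inj₁ qx = begin
    suc (count P? xs)                      ≤⟨ s≤s (count-∪ R? P⇒Q∪R xs) ⟩
    suc (count Q? xs + count R? xs)        ≡⟨ cong (_+ count R? xs) (sym (count-accept Q? qx)) ⟩
    count Q? (x ∷ xs) + count R? xs        ≤⟨ +-monoʳ-≤ _ (count-cons R? x xs) ⟩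
    count Q? (x ∷ xs) + count R? (x ∷ xs)  ∎
    where open ≤-Reasoning
  ...   | inj₂ rx = begin
    suc (count P? xs)                      ≤⟨ s≤s (count-∪ R? P⇒Q∪R xs) ⟩
    suc (count Q? xs + count R? xs)        ≡⟨ sym (+-suc _ _) ⟩
    count Q? xs + suc (count R? xs)        ≡⟨ cong (count Q? xs +_) (sym (count-accept R? rx)) ⟩
    count Q? xs + count R? (x ∷ xs)        ≤⟨ +-mono-≤ (count-cons Q? x xs) ≤-refl ⟩
    count Q? (x ∷ xs) + count R? (x ∷ xs)  ∎
    where open ≤-Reasoning

count-unique : (_≟_ : DecidableEquality X) (x : X) {xs : List X} → Unique xs → count (x ≟_) xs ≤ 1
count-unique _≟_ x {[]}     _ = z≤n
count-unique _≟_ x {y ∷ ys} (y∉ys ∷ unique) with x ≟ y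
... | yes refl = s≤s (≤-reflexive (count-none (x ≟_) y∉ys))
... | no _     = count-unique _≟_ x unique

elemB-sound : {x : ℕ} (xs : List ℕ) → T (elemB x xs) → x ∈ xs
elemB-sound xs t = Any.map toWitness (any⁻ _ xs t)

endsIn? : (U : List ℕ) → Decidable (λ (ab : ℕ × ℕ) → T (elemB (proj₂ ab) U))
endsIn? U ab = T? (elemB (proj₂ ab) U)

joined? : (A : Arcs) (U : List ℕ) → Decidable (λ j → T (joinedTo A U j))
joined? A U j = T? (joinedTo A U j)

joined-cons : ∀ {a b j} (A : Arcs) (U : List ℕ) → T (joinedTo ((a , b) ∷ A) U j) →
              (a ≡ j × T (elemB b U)) ⊎ T (joinedTo A U j)
joined-cons A U t with Equivalence.to T-∨ t
... | inj₁ t₁ with Equivalence.to T-∧ t₁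
...   | t-eq , t-end = inj₁ (toWitness t-eq , t-end)
joined-cons A U t | inj₂ t₂ = inj₂ t₂

-- Each arc ending in U joins at most one entry of a row without repeats,
-- so the number of joined entries is at most the number of arcs into U.
joined-count : (A : Arcs) (U L : List ℕ) → Unique L →
               count (joined? A U) L ≤ count (endsIn? U) A
joined-count [] U L _ = ≤-reflexive (count-none (joined? [] U) (All.universal (λ _ ()) L))
joined-count ((a , b) ∷ A) U L unique with T? (elemB b U)
... | yes b∈U = begin
  count (joined? ((a , b) ∷ A) U) L         ≤⟨ count-∪ (joined? ((a , b) ∷ A) U) (a ≟_) (joined? A U)
                                                 (map₁ proj₁ ∘ joined-cons A U) L ⟩
  count (a ≟_) L + count (joined? A U) L    ≤⟨ +-mono-≤ (count-unique _≟_ a unique) (joined-count A U L unique) ⟩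
  suc (count (endsIn? U) A)                 ≡⟨ sym (count-accept (endsIn? U) b∈U) ⟩
  count (endsIn? U) ((a , b) ∷ A)           ∎
  where open ≤-Reasoning
        open Data.Nat using (_≟_)
... | no b∉U = begin
  count (joined? ((a , b) ∷ A) U) L   ≤⟨ count-mono (joined? ((a , b) ∷ A) U) (joined? A U) L
                                          (λ _ → [ ⊥-elim ∘ b∉U ∘ proj₂ , id ] ∘ joined-cons A U) ⟩
  count (joined? A U) L               ≤⟨ joined-count A U L unique ⟩
  count (endsIn? U) A                 ≡⟨ sym (count-reject (endsIn? U) b∉U) ⟩
  count (endsIn? U) ((a , b) ∷ A)     ∎
  where open ≤-Reasoning

step-adds-at-most-one : (τ : Tableau) (A : Arcs) (i : ℕ) →
                        step τ A i ≡ A ⊎ ∃[ j ] step τ A i ≡ A ++ (j , i) ∷ []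
step-adds-at-most-one τ A i with rowOf τ i
... | nothing      = inj₁ refl
... | just zero    = inj₁ refl
... | just (suc k) with maxL (candidates τ k A i)
...   | nothing = inj₁ refl
...   | just j  = inj₂ (j , refl)

-- An arc (j , b) ends in U only if b ∈ U, and then b is an entry of U
-- counted below b + 1 but not below b.
new-arc-count : (U : List ℕ) (j b : ℕ) →
                count (_<? b) U + count (endsIn? U) ((j , b) ∷ []) ≤ count (_<? suc b) U
new-arc-count U j b with T? (elemB b U)
... | yes b∈U = begin
  count (_<? b) U + count (endsIn? U) ((j , b) ∷ [])  ≡⟨ cong (count (_<? b) U +_) (count-accept (endsIn? U) b∈U) ⟩
  count (_<? b) U + 1                                ≡⟨ +-comm _ 1 ⟩
  suc (count (_<? b) U)                              ≤⟨ count-mono-strict (_<? b) (_<? suc b) (λ _ → m<n⇒m<1+n)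
                                                          (elemB-sound U b∈U) ≤-refl (<-irrefl refl) ⟩
  count (_<? suc b) U                                ∎
  where open ≤-Reasoning
... | no b∉U = begin
  count (_<? b) U + count (endsIn? U) ((j , b) ∷ [])  ≡⟨ cong (count (_<? b) U +_) (count-reject (endsIn? U) b∉U) ⟩
  count (_<? b) U + 0                                ≡⟨ +-identityʳ _ ⟩
  count (_<? b) U                                    ≤⟨ count-mono (_<? b) (_<? suc b) U (λ _ → m<n⇒m<1+n) ⟩
  count (_<? suc b) U                                ∎
  where open ≤-Reasoning

arcs-ending-in : (τ : Tableau) (U : List ℕ) (n : ℕ) →
                 count (endsIn? U) (arcsUpTo τ n) ≤ count (_<? suc n) U
arcs-ending-in τ U zero    = z≤n
arcs-ending-in τ U (suc n) with step-adds-at-most-one τ (arcsUpTo τ n) (suc n)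
... | inj₁ unchanged = begin
  count (endsIn? U) (step τ (arcsUpTo τ n) (suc n))  ≡⟨ cong (count (endsIn? U)) unchanged ⟩
  count (endsIn? U) (arcsUpTo τ n)                   ≤⟨ arcs-ending-in τ U n ⟩
  count (_<? suc n) U                                ≤⟨ count-mono (_<? suc n) (_<? suc (suc n)) U (λ _ → m<n⇒m<1+n) ⟩
  count (_<? suc (suc n)) U                          ∎
  where open ≤-Reasoning
... | inj₂ (j , extended) = begin
  count (endsIn? U) (step τ (arcsUpTo τ n) (suc n))  ≡⟨ cong (count (endsIn? U)) extended ⟩
  count (endsIn? U) (arcsUpTo τ n ++ (j , suc n) ∷ [])
    ≡⟨ count-++ (endsIn? U) (arcsUpTo τ n) _ ⟩
  count (endsIn? U) (arcsUpTo τ n) + count (endsIn? U) ((j , suc n) ∷ [])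
    ≤⟨ +-mono-≤ (arcs-ending-in τ U n) ≤-refl ⟩
  count (_<? suc n) U + count (endsIn? U) ((j , suc n) ∷ [])
    ≤⟨ new-arc-count U j (suc n) ⟩
  count (_<? suc (suc n)) U                          ∎
  where open ≤-Reasoning

no-candidate⇒joined : (τ : Tableau) (k : ℕ) (A : Arcs) (i : ℕ) → candidates τ k A i ≡ [] →
                      count (_<? i) (rowAt τ k) ≤ count (joined? A (rowAt τ (suc k))) (rowAt τ k)
no-candidate⇒joined τ k A i none =
  count-mono (_<? i) (joined? A (rowAt τ (suc k))) (rowAt τ k) joined
  where
    -- an unjoined j < i would be a member of the empty candidate list
    joined : ∀ {j} → j ∈ rowAt τ k → j < i → T (joinedTo A (rowAt τ (suc k)) j)
    joined {j} j∈L j<i with joinedTo A (rowAt τ (suc k)) j in eq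
    ... | true  = _
    ... | false with subst (j ∈_) none (∈-filter⁺ _ j∈L (j<i , subst (T ∘ not) (sym eq) _))
    ...   | ()

-- For i ∈ U, the entries of L below i include the
-- one under i, while the entries of U below i sit over entries of L below i.
column-count : (i : ℕ) (L U : List ℕ) → AllPairs _<_ U →
               (∀ c → c < length U → entryAt L c < entryAt U c) →
               length U ≤ length L → i ∈ U →
               count (_<? i) U < count (_<? i) L
column-count i [] (u ∷ U) _ _ () _
column-count i (l ∷ L) (u ∷ U) (u<U ∷ _) columns _ (here refl) = begin-strict
  count (_<? u) (u ∷ U)  ≡⟨ count-reject (_<? u) (<-irrefl refl) ⟩
  count (_<? u) U        ≡⟨ count-none (_<? u) (All.map (λ u<x x<u → <-asym u<x x<u) u<U) ⟩
  0                      <⟨ z<s ⟩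
  suc (count (_<? u) L)  ≡⟨ sym (count-accept (_<? u) (columns 0 z<s)) ⟩
  count (_<? u) (l ∷ L)  ∎
  where open ≤-Reasoning
column-count i (l ∷ L) (u ∷ U) (u<U ∷ increasing) columns (s≤s lengths) (there i∈U) = begin-strict
  count (_<? i) (u ∷ U)  ≡⟨ count-accept (_<? i) u<i ⟩
  suc (count (_<? i) U)  <⟨ s<s (column-count i L U increasing (λ c → columns (suc c) ∘ s<s) lengths i∈U) ⟩
  suc (count (_<? i) L)  ≡⟨ sym (count-accept (_<? i) (<-trans (columns 0 z<s) u<i)) ⟩
  count (_<? i) (l ∷ L)  ∎
  where open ≤-Reasoning
        u<i = All.lookup u<U i∈U

rowAt-all : {P : List ℕ → Set} (τ : Tableau) → All P τ → P [] → (k : ℕ) → P (rowAt τ k)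
rowAt-all []      []         p[] k       = p[]
rowAt-all (r ∷ τ) (pr ∷ _)   p[] zero    = pr
rowAt-all (r ∷ τ) (_ ∷ prs)  p[] (suc k) = rowAt-all τ prs p[] k

rowAt-length : (τ : Tableau) → Linked (λ a b → b ≤ a) (shape τ) → (k : ℕ) →
               length (rowAt τ (suc k)) ≤ length (rowAt τ k)
rowAt-length []           _                k       = z≤n
rowAt-length (r ∷ [])     _                k       = z≤n
rowAt-length (r ∷ s ∷ τ) (s≤r ∷ _)        zero    = s≤r
rowAt-length (r ∷ s ∷ τ) (_ ∷ decreasing) (suc k) = rowAt-length (s ∷ τ) decreasing k

rowAt⊆concat : (τ : Tableau) (k : ℕ) → x ∈ rowAt τ k → x ∈ concat τ
rowAt⊆concat (r ∷ τ) zero    x∈r = ∈-++⁺ˡ x∈r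
rowAt⊆concat (r ∷ τ) (suc k) x∈τ = ∈-++⁺ʳ r (rowAt⊆concat τ k x∈τ)

entry-positive : (τ : Tableau) → concat τ ↭ map suc (upTo (size τ)) →
                 (k i : ℕ) → i ∈ rowAt τ k → ∃[ m ] i ≡ suc m
entry-positive τ entries k i i∈row with ∈-map⁻ suc (∈-resp-↭ entries (rowAt⊆concat τ k i∈row))
... | m , _ , i≡1+m = m , i≡1+m

row-strict : (τ : Tableau) → All (Linked _<_) τ → (k : ℕ) → AllPairs _<_ (rowAt τ k)
row-strict τ rows = rowAt-all τ (All.map (Linked⇒AllPairs <-trans) rows) AllPairs.[]

lemma2p3 : (T : Tableau) → IsSYT T → (i k : ℕ) → i ∈ rowAt T (suc k) →
    candidates T k (arcsUpTo T (i ∸ 1)) i ≢ []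
lemma2p3 T (partition , entries , rows , columns) i k i∈U no-candidate
  with entry-positive T entries (suc k) i i∈U
... | m , refl = <-irrefl refl (begin-strict
  count (_<? i) U               <⟨ column-count i L U (row-strict T rows (suc k)) (columns k)
                                     (rowAt-length T (proj₂ partition) k) i∈U ⟩
  count (_<? i) L               ≤⟨ no-candidate⇒joined T k A i no-candidate ⟩
  count (joined? A U) L         ≤⟨ joined-count A U L (AllPairs.map <⇒≢ (row-strict T rows k)) ⟩
  count (endsIn? U) A           ≤⟨ arcs-ending-in T U m ⟩
  count (_<? i) U               ∎)
  where
    open ≤-Reasoning
    L = rowAt T k
    U = rowAt T (suc k)
    A = arcsUpTo T m
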